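{- Let $\mathbb{C}$ be a finite set of non-trivial clauses and $N(\mathbb{C})$ its negated configuration. A truth value assignment satisfies $\mathbb{C}$ (i.e., every clause in $\mathbb{C}$) if and only if it falsifies $N(\mathbb{C})$ (i.e., falsifies at least one clause of $N(\mathbb{C})$). In other words, $\mathbb{C}$ is logically equivalent to $\neg \bigwedge_{D\in N(\mathbb{C})} D$.
   Context: A literal is a Boolean variable $x$ or its negation $\overline{x}$, with $\overline{\overline{x}}=x$. A clause is a disjunction (set) of literals; it is trivial if it contains a variable and its negation; $0$ denotes the empty clause. A clause $C'$ subsumes a clause $C$ if every literal of $C'$ appears in $C$. The negated configuration $N(\mathbb{C})$ of a finite set of clauses $\mathbb{C}$ is defined by induction on $|\mathbb{C}|$: $N(\emptyset)=\{0\}$, and $N(\mathbb{C}\cup\{C\})=\{D\lor \overline{a} : D\in N(\mathbb{C}),\ a\in C\}$, where trivial clauses and clauses subsumed by other clauses are removed from the resulting set. -}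

module Defs where

open import Data.Nat using (ℕ)
import Data.Nat.Properties as ℕP
open import Data.Bool using (Bool; true; false; not; _∧_; _∨_; if_then_else_)
import Data.Bool.Properties as BP
open import Data.Product using (_×_; _,_; proj₁; proj₂; ∃-syntax)
open import Data.Product.Properties using (≡-dec)
open import Data.List using (List; []; _∷_; _++_; [_]; concatMap; map; filter)
open import Data.Bool.ListAction using (any)
open import Data.List.Relation.Unary.All using (All; all?)
open import Data.List.Relation.Unary.Any using (Any)
open import Relation.Nullary using (Dec; ¬_)
open import Relation.Nullary.Decidable using (⌊_⌋; ¬?)
open import Relation.Binary.PropositionalEquality using (_≡_)
open import Relation.Binary.Definitions using (DecidableEquality)

Var : Set
Var = ℕ

-- A literal: a variable with a polarity (true = x, false = negation of x).
Literal : Set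
Literal = Var × Bool

_≟ₗ_ : DecidableEquality Literal
_≟ₗ_ = ≡-dec ℕP._≟_ BP._≟_

open import Data.List.Membership.DecPropositional _≟ₗ_ public
  using (_∈_; _∈?_)

‾_ : Literal → Literal
‾ (x , b) = (x , not b)

-- A clause is a (finite) disjunction of literals, represented as a list
-- (read as a set; 0 is the empty list).
Clause : Set
Clause = List Literal

Trivial : Clause → Set
Trivial C = ∃[ l ] (l ∈ C × ‾ l ∈ C)

trivial? : Clause → Bool
trivial? C = any (λ l → ⌊ ‾ l ∈? C ⌋) C

Subsumes : Clause → Clause → Set
Subsumes C' C = All (_∈ C) C'

subsumes? : Clause → Clause → Bool
subsumes? C' C = ⌊ all? (_∈? C) C' ⌋

-- A clause D is removed
-- if an earlier clause subsumes it (this also removes duplicates, keeping the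
-- first copy), or a later clause strictly subsumes it.
pruneSub : List Clause → List Clause → List Clause
pruneSub pre [] = []
pruneSub pre (D ∷ rest) =
  if any (λ E → subsumes? E D) pre
     ∨ any (λ E → subsumes? E D ∧ not (subsumes? D E)) rest
  then pruneSub (pre ++ [ D ]) rest
  else D ∷ pruneSub (pre ++ [ D ]) rest

normalize : List Clause → List Clause
normalize Ds = pruneSub [] (filter (λ D → ¬? (trivial?' D)) Ds)
  where
  open import Data.Bool using (T)
  open import Data.Bool.Properties using (T?)
  trivial?' : (D : Clause) → Dec (T (trivial? D))
  trivial?' D = T? (trivial? D)

-- Negated configuration, by induction on the (finite) set of clauses, given
-- as a list:  N(∅) = {0},  N(ℂ ∪ {C}) = { D ∨ ‾a : D ∈ N(ℂ), a ∈ C }, normalized.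
N : List Clause → List Clause
N [] = [] ∷ []
N (C ∷ ℂ) = normalize (concatMap (λ D → map (λ a → D ++ [ ‾ a ]) C) (N ℂ))

Assignment : Set
Assignment = Var → Bool

evalLit : Assignment → Literal → Bool
evalLit σ (x , true)  = σ x
evalLit σ (x , false) = not (σ x)

SatClause : Assignment → Clause → Set
SatClause σ C = Any (λ l → evalLit σ l ≡ true) C

FalsClause : Assignment → Clause → Set
FalsClause σ C = All (λ l → evalLit σ l ≡ false) C

Satisfies : Assignment → List Clause → Set
Satisfies σ ℂ = All (SatClause σ) ℂ

Falsifies : Assignment → List Clause → Set
Falsifies σ ℂ = Any (FalsClause σ) ℂ

-- An assignment falsifies D ∨ ‾a exactly when it falsifies D and
-- makes a true, so it falsifies one of the clauses D ∨ ‾a built from N(ℂ) and C iff it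
-- falsifies some D ∈ N(ℂ) and satisfies C.  Normalisation preserves this: a falsified
-- clause is never trivial, and pruning keeps, for every clause D, some clause subsuming
-- D (namely the first occurrence of a subsumer of D that is minimal for subsumption),
-- and subsumers of falsified clauses are falsified.
module Submission where

open import Defs hiding (_∈_)
open import Data.List using (List)
open import Data.List.Relation.Unary.All using (All)
open import Relation.Nullary using (¬_)
open import Function.Bundles using (_⇔_)

open import Data.Bool using (Bool; true; false; not; _∧_; _∨_; T)
open import Data.Bool.Properties using (not-involutive; not-injective; not-¬)
open import Data.Bool.ListAction using (any)
open import Data.Nat using (ℕ; zero; suc; _≤_; _<_; s≤s; z≤n)
open import Data.Nat.Properties using (m≤n⇒m≤1+n; <-≤-trans; n<1+n; ≤-pred)
open import Data.Product using (_×_; _,_; proj₂; ∃-syntax; swap; uncurry)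
open import Data.Product.Function.NonDependent.Propositional using (_×-⇔_)
open import Data.List using ([]; _∷_; _++_; [_]; concatMap; map)
open import Data.List.Properties using (++-assoc; ++-identityʳ)
import Data.List.Relation.Unary.All as All
open import Data.List.Relation.Unary.All.Properties using (++⁺; ++⁻)
open import Data.List.Relation.Unary.All.Properties.Core using (¬Any⇒All¬; ¬All⇒Any¬)
open import Data.List.Relation.Unary.Any using (Any; here; there; any?)
import Data.List.Relation.Unary.Any as Any
open import Data.List.Relation.Unary.Any.Properties
  using (any⁻; filter⁻; map⁺; map⁻; concatMap⁺; concatMap⁻; Any-×⁺; Any-×⁻)
import Data.List.Relation.Unary.First as First
open import Data.List.Relation.Unary.First.Properties using (toView)
open import Data.List.Membership.Propositional using (_∈_; find; lose)
open import Data.List.Membership.Propositional.Properties using (∈-filter⁺)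
open import Relation.Nullary using (Dec; yes; no; contradiction)
open import Relation.Nullary.Decidable
  using (⌊_⌋; isYes≗does; dec-false; toWitness; toSum; _×-dec_; ¬?)
open import Relation.Unary using (Pred)
open import Relation.Binary.PropositionalEquality using (_≡_; refl; sym; trans; cong; subst)
open import Function.Base using (_∘_)
open import Function.Bundles using (mk⇔; Equivalence)
open import Function.Related.Propositional using (module EquationalReasoning)
import Function.Properties.Equivalence as ⇔

evalLit-‾ : ∀ σ l → evalLit σ (‾ l) ≡ not (evalLit σ l)
evalLit-‾ σ (x , true)  = refl
evalLit-‾ σ (x , false) = sym (not-involutive (σ x))

evalLit-‾-false : ∀ σ l → evalLit σ (‾ l) ≡ false → evalLit σ l ≡ true
evalLit-‾-false σ l ‾l-false = not-injective (trans (sym (evalLit-‾ σ l)) ‾l-false)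

StrictlySubsumes : Clause → Clause → Set
StrictlySubsumes E D = Subsumes E D × ¬ Subsumes D E

subsumes-dec : ∀ E D → Dec (Subsumes E D)
subsumes-dec E D = All.all? (_∈? D) E

strictlySubsumes-dec : ∀ E D → Dec (StrictlySubsumes E D)
strictlySubsumes-dec E D = subsumes-dec E D ×-dec ¬? (subsumes-dec D E)

subsumes-refl : ∀ D → Subsumes D D
subsumes-refl D = All.tabulate (λ l∈D → l∈D)

subsumes-trans : ∀ {F E D} → Subsumes F E → Subsumes E D → Subsumes F D
subsumes-trans F⊆E E⊆D = All.map (All.lookup E⊆D) F⊆E

subsumes?-false : ∀ E D → ¬ Subsumes E D → subsumes? E D ≡ false
subsumes?-false E D E⊈D = trans (isYes≗does (subsumes-dec E D)) (dec-false (subsumes-dec E D) E⊈D)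

strictlySubsumes?-false : ∀ E D → ¬ StrictlySubsumes E D →
                          (subsumes? E D ∧ not (subsumes? D E)) ≡ false
strictlySubsumes?-false E D ¬E⊂D with subsumes-dec E D
... | no _ = refl
... | yes E⊆D with subsumes-dec D E
...   | yes _    = refl
...   | no D⊈E   = contradiction (E⊆D , D⊈E) ¬E⊂D

any-false : ∀ {A : Set} (p : A → Bool) {xs} → All (λ x → p x ≡ false) xs → any p xs ≡ false
any-false p All.[]           = refl
any-false p (px≡f All.∷ pxs) rewrite px≡f = any-false p pxs

pruneSub⁻ : ∀ {ℓ} {P : Pred Clause ℓ} pre xs → Any P (pruneSub pre xs) → Any P xs
pruneSub⁻ pre (D ∷ rest) p
  with any (λ E → subsumes? E D) pre ∨ any (λ E → subsumes? E D ∧ not (subsumes? D E)) rest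
... | true = there (pruneSub⁻ (pre ++ [ D ]) rest p)
pruneSub⁻ pre (D ∷ rest) (here q)  | false = here q
pruneSub⁻ pre (D ∷ rest) (there q) | false = there (pruneSub⁻ (pre ++ [ D ]) rest q)

∈-pruneSub-∷ : ∀ {D} pre y rest → D ∈ pruneSub (pre ++ [ y ]) rest → D ∈ pruneSub pre (y ∷ rest)
∈-pruneSub-∷ pre y rest D∈
  with any (λ E → subsumes? E y) pre ∨ any (λ E → subsumes? E y ∧ not (subsumes? y E)) rest
... | true  = D∈
... | false = there D∈

∈-pruneSub⁺ : ∀ pre ys {D} zs →
              All (λ E → ¬ Subsumes E D) (pre ++ ys) →
              All (λ E → ¬ StrictlySubsumes E D) zs →
              D ∈ pruneSub pre (ys ++ D ∷ zs)
∈-pruneSub⁺ pre [] {D} zs ¬earlier ¬later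
  rewrite any-false (λ E → subsumes? E D)
            (All.map (λ {E} → subsumes?-false E D) (subst (All _) (++-identityʳ pre) ¬earlier))
        | any-false (λ E → subsumes? E D ∧ not (subsumes? D E))
            (All.map (λ {E} → strictlySubsumes?-false E D) ¬later)
  = here refl
∈-pruneSub⁺ pre (y ∷ ys) zs ¬earlier ¬later =
  ∈-pruneSub-∷ pre y (ys ++ _ ∷ zs)
    (∈-pruneSub⁺ (pre ++ [ y ]) ys zs (subst (All _) (sym (++-assoc pre [ y ] ys)) ¬earlier) ¬later)

countIn : Clause → List Literal → ℕ
countIn E [] = 0
countIn E (l ∷ V) with l ∈? E
... | yes _ = suc (countIn E V)
... | no _  = countIn E V

countIn-mono : ∀ {G E} → Subsumes G E → ∀ V → countIn G V ≤ countIn E V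
countIn-mono G⊆E [] = z≤n
countIn-mono {G} {E} G⊆E (l ∷ V) with l ∈? G | l ∈? E
... | yes _   | yes _   = s≤s (countIn-mono G⊆E V)
... | yes l∈G | no l∉E  = contradiction (All.lookup G⊆E l∈G) l∉E
... | no _    | yes _   = m≤n⇒m≤1+n (countIn-mono G⊆E V)
... | no _    | no _    = countIn-mono G⊆E V

countIn-strict : ∀ {G E d} → Subsumes G E → d ∈ E → ¬ d ∈ G →
                 ∀ V → d ∈ V → countIn G V < countIn E V
countIn-strict {G} {E} G⊆E d∈E d∉G (l ∷ V) d∈l∷V with l ∈? G | l ∈? E | d∈l∷V
... | yes l∈G | no l∉E  | _           = contradiction (All.lookup G⊆E l∈G) l∉E
... | yes l∈G | yes _   | here refl   = contradiction l∈G d∉G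
... | yes _   | yes _   | there d∈V   = s≤s (countIn-strict G⊆E d∈E d∉G V d∈V)
... | no _    | yes _   | here refl   = s≤s (countIn-mono G⊆E V)
... | no _    | yes _   | there d∈V   = m≤n⇒m≤1+n (countIn-strict G⊆E d∈E d∉G V d∈V)
... | no _    | no l∉E  | here refl   = contradiction d∈E l∉E
... | no _    | no _    | there d∈V   = countIn-strict G⊆E d∈E d∉G V d∈V

minimalSubsumer : ∀ L {C} → C ∈ L →
                  ∃[ E ] (E ∈ L × Subsumes E C × All (λ G → ¬ StrictlySubsumes G E) L)
minimalSubsumer L {C} C∈L = descend (suc (countIn C C)) C∈L (subsumes-refl C) (n<1+n _)
  where
  descend : ∀ n {E} → E ∈ L → Subsumes E C → countIn E C < n →
            ∃[ E ] (E ∈ L × Subsumes E C × All (λ G → ¬ StrictlySubsumes G E) L)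
  descend zero    _   _   ()
  descend (suc n) {E} E∈L E⊆C bound with any? (λ G → strictlySubsumes-dec G E) L
  ... | no ¬below = E , E∈L , E⊆C , ¬Any⇒All¬ L ¬below
  ... | yes below with find below
  ...   | G , G∈L , G⊆E , E⊈G with find (¬All⇒Any¬ (_∈? G) E E⊈G)
  ...     | d , d∈E , d∉G =
    descend n G∈L (subsumes-trans G⊆E E⊆C)
      (<-≤-trans (countIn-strict G⊆E d∈E d∉G C (All.lookup E⊆C d∈E)) (≤-pred bound))

strictlySubsumes-subsumes-trans : ∀ {G F E} → StrictlySubsumes G F → Subsumes F E →
                                  StrictlySubsumes G E
strictlySubsumes-subsumes-trans (G⊆F , F⊈G) F⊆E =
  subsumes-trans G⊆F F⊆E , λ E⊆G → F⊈G (subsumes-trans F⊆E E⊆G)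

-- The first subsumer F of a minimal subsumer E is kept: an earlier subsumer of F would
-- come before F and subsume E, and a later strict subsumer of F would strictly subsume E.
pruneSub-subsumer : ∀ L {C} → C ∈ L → ∃[ F ] (F ∈ pruneSub [] L × Subsumes F C)
pruneSub-subsumer L C∈L with minimalSubsumer L C∈L
... | E , E∈L , E⊆C , E-minimal
  with toView (First.refine (λ {G} _ → toSum (subsumes-dec G E))
                            (First.fromAny (Any.map (λ { refl → subsumes-refl E }) E∈L)))
... | First._++_∷_ {ys} {F} ¬earlier F⊆E zs =
  F , ∈-pruneSub⁺ [] ys zs
        (All.map (λ G⊈E G⊆F → G⊈E (subsumes-trans G⊆F F⊆E)) ¬earlier)
        (All.map (λ ¬G⊂E G⊂F → ¬G⊂E (strictlySubsumes-subsumes-trans G⊂F F⊆E))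
                 (All.tail (proj₂ (++⁻ ys E-minimal))))
    , subsumes-trans F⊆E E⊆C

module _ (σ : Assignment) where

  falsifies-antitone : ∀ {E D} → Subsumes E D → FalsClause σ D → FalsClause σ E
  falsifies-antitone E⊆D σ⊭D = All.map (All.lookup σ⊭D) E⊆D

  falsifies⇒¬Trivial : ∀ {D} → FalsClause σ D → ¬ Trivial D
  falsifies⇒¬Trivial σ⊭D (l , l∈D , ‾l∈D) =
    not-¬ (All.lookup σ⊭D l∈D) (evalLit-‾-false σ l (All.lookup σ⊭D ‾l∈D))

  trivial?-sound : ∀ D → T (trivial? D) → Trivial D
  trivial?-sound D t with find (any⁻ (λ l → ⌊ ‾ l ∈? D ⌋) D t)
  ... | l , l∈D , ‾l∈?D = l , l∈D , toWitness ‾l∈?D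

  falsifies-normalize : ∀ Ds → Falsifies σ Ds ⇔ Falsifies σ (normalize Ds)
  falsifies-normalize Ds = mk⇔ to (λ p → filter⁻ _ (pruneSub⁻ [] _ p))
    where
    to : Falsifies σ Ds → Falsifies σ (normalize Ds)
    to p with find p
    ... | D , D∈Ds , σ⊭D
      with pruneSub-subsumer _ (∈-filter⁺ _ D∈Ds (λ t → falsifies⇒¬Trivial σ⊭D (trivial?-sound D t)))
    ... | F , F∈ , F⊆D = lose F∈ (falsifies-antitone F⊆D σ⊭D)

  falsifies-++-‾ : ∀ D a → (FalsClause σ D × evalLit σ a ≡ true) ⇔ FalsClause σ (D ++ [ ‾ a ])
  falsifies-++-‾ D a = mk⇔
    (λ (σ⊭D , a-true) → ++⁺ σ⊭D (trans (evalLit-‾ σ a) (cong not a-true) All.∷ All.[]))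
    from
    where
    from : FalsClause σ (D ++ [ ‾ a ]) → FalsClause σ D × evalLit σ a ≡ true
    from σ⊭D‾a with ++⁻ D σ⊭D‾a
    ... | σ⊭D , ‾a-false All.∷ All.[] = σ⊭D , evalLit-‾-false σ a ‾a-false

  extensions : Clause → List Clause → List Clause
  extensions C Ns = concatMap (λ D → map (λ a → D ++ [ ‾ a ]) C) Ns

  falsifies-extensions : ∀ C Ns → (SatClause σ C × Falsifies σ Ns) ⇔ Falsifies σ (extensions C Ns)
  falsifies-extensions C Ns = mk⇔
    (λ (σ⊨C , σ⊭Ns) →
       concatMap⁺ _ (Any.map (λ {D} → map⁺ ∘ Any.map (Equivalence.to (falsifies-++-‾ D _)))
                             (Any-×⁺ (σ⊭Ns , σ⊨C))))
    (λ p →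
       swap (Any-×⁻ (Any.map (λ {D} → Any.map (Equivalence.from (falsifies-++-‾ D _)) ∘ map⁻)
                             (concatMap⁻ _ p))))

  satisfies⇔falsifies-N : ∀ ℂ → Satisfies σ ℂ ⇔ Falsifies σ (N ℂ)
  satisfies⇔falsifies-N []      = mk⇔ (λ _ → here All.[]) (λ _ → All.[])
  satisfies⇔falsifies-N (C ∷ ℂ) = begin
    Satisfies σ (C ∷ ℂ)                     ∼⟨ mk⇔ All.uncons (uncurry All._∷_) ⟩
    (SatClause σ C × Satisfies σ ℂ)         ∼⟨ ⇔.refl ×-⇔ satisfies⇔falsifies-N ℂ ⟩
    (SatClause σ C × Falsifies σ (N ℂ))     ∼⟨ falsifies-extensions C (N ℂ) ⟩
    Falsifies σ (extensions C (N ℂ))        ∼⟨ falsifies-normalize _ ⟩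
    Falsifies σ (N (C ∷ ℂ))                 ∎
    where open EquationalReasoning

mainTheorem3 : (ℂ : List Clause) → All (λ C → ¬ Trivial C) ℂ →
    (σ : Assignment) → Satisfies σ ℂ ⇔ Falsifies σ (N ℂ)
mainTheorem3 ℂ _ σ = satisfies⇔falsifies-N σ ℂ
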